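{- For a positive integer $n$, let $u=-2+2T_n(5/2)$ and $v=U_{n-1}(5/2)$ (both integers). Then $$\frac{\gcd(u,nv)}{\gcd(n,u,v)}=\gcd(u,v).$$
   Context: $T_n(x)=\cos(n\arccos x)$ is the Chebyshev polynomial of the first kind and $U_{n-1}(x)=\frac{\sin(n\arccos x)}{\sin(\arccos x)}$ is the Chebyshev polynomial of the second kind (both polynomials in $x$, evaluated at $x=5/2$). -}

module Defs where

open import Data.Nat using (ℕ; zero; suc)
open import Data.Integer using (ℤ; +_)
open import Data.Rational using (ℚ; 0ℚ; 1ℚ; _+_; _*_; _-_; _/_)

T : ℕ → ℚ → ℚ
T zero x = 1ℚ
T (suc zero) x = x
T (suc (suc k)) x = ((+ 2 / 1) * x) * T (suc k) x - T k x

U : ℕ → ℚ → ℚ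
U zero x = 1ℚ
U (suc zero) x = (+ 2 / 1) * x
U (suc (suc k)) x = ((+ 2 / 1) * x) * U (suc k) x - U k x

five/2 : ℚ
five/2 = + 5 / 2

ι : ℤ → ℚ
ι z = z / 1

module Submission where

-- Let α = (5 + √21)/2. Then L n = 2 T_n(5/2) = αⁿ + α⁻ⁿ and F n = U_{n-1}(5/2) = (αⁿ - α⁻ⁿ)/√21 are the
-- Lucas sequences of x² - 5x + 1, so u = L n - 2 and v = F n. By the doubling formulas, for n = 2k + 1
-- u = 3a² and v = ab with a = F k + F (k+1), b = F (k+1) - F k and 7b² = 3a² + 4, while for n = 2k
-- u = 21c² and v = cd with c = F k, d = L k and d² = 21c² + 4. These equations give gcd(u, v) = g with
-- u = g u′, v = g v′, where u′ and g differ only by factors 2, 3 and 7 (e.g. u′ = 3a, g = a), and the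
-- identity becomes gcd(n, u′) = gcd(n, g). It holds because pⁱ ∣ n ⇒ pⁱ ∣ F n for p = 3, 7 (as p F m
-- divides F (p m)) and, when c is even, 2ⁱ ∣ n ⇒ 2ⁱ⁺¹ ∣ c (then 3 ∣ k, and 8 · 2ʲ ∣ F (3 · 2ʲ t)).

open import Defs
open import Data.List.Base using (_∷_; [])
open import Data.Nat using (ℕ; zero; suc; NonZero)
open import Data.Integer using (ℤ; +_; -_; ∣_∣)
open import Data.Product using (∃; _,_)
open import Data.Sum using (_⊎_; inj₁; inj₂)
open import Data.Rational using (_/_)
open import Relation.Nullary using (¬_; yes; no; contradiction)
open import Relation.Nullary.Decidable using (from-yes; from-no)
open import Relation.Binary.PropositionalEquality

-- Gcd arithmetic
module _ where
  open import Data.Nat using (_+_; _*_; _^_; _<_; nonTrivial⇒n>1)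
  open import Data.Nat.Properties
    using (+-comm; *-comm; *-assoc; *-identityʳ; ^-identityʳ; m<m*n; m*n≢0⇒m≢0; *-cancelˡ-≡)
  open import Data.Nat.Divisibility
  open import Data.Nat.GCD
  open import Data.Nat.Coprimality as Coprime using (Coprime; coprime-divisor; coprime⇒gcd≡1)
  open import Data.Nat.Primality
    using (Prime; prime[2]; prime⇒irreducible; prime⇒nonZero; prime⇒nonTrivial; prime?; euclidsLemma)
  open import Data.Nat.Induction using (<-wellFounded)
  open import Data.Nat.Tactic.RingSolver using (solve)
  open import Induction.WellFounded using (Acc; acc)

  GcdIdentity : ℕ → ℕ → ℕ → Set
  GcdIdentity n u v = gcd u (n * v) ≡ gcd (gcd n u) v * gcd u v

  gcd[m,k*n]≡gcd[m,n] : ∀ {m k} n → Coprime m k → gcd m (k * n) ≡ gcd m n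
  gcd[m,k*n]≡gcd[m,n] {m} {k} n m⊥k = ∣-antisym
    (gcd-greatest (gcd[m,n]∣m m (k * n)) (coprime-divisor g⊥k (gcd[m,n]∣n m (k * n))))
    (gcd-greatest (gcd[m,n]∣m m n) (∣n⇒∣m*n k (gcd[m,n]∣n m n)))
    where
    g⊥k : Coprime (gcd m (k * n)) k
    g⊥k (d∣g , d∣k) = m⊥k (∣-trans d∣g (gcd[m,n]∣m m (k * n)) , d∣k)

  -- Here g = gcd U V, and both sides reduce to g * gcd n g.
  gcd-identity-by-cofactors : ∀ n {U V} g u v → U ≡ g * u → V ≡ g * v → Coprime u v → gcd n u ≡ gcd n g →
    GcdIdentity n U V
  gcd-identity-by-cofactors n g u v refl refl u⊥v n⊓u≡n⊓g = begin
    gcd (g * u) (n * (g * v))                         ≡⟨ cong (gcd (g * u)) (solve (n ∷ g ∷ v ∷ [])) ⟩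
    gcd (g * u) (g * (v * n))                         ≡⟨ c*gcd[m,n]≡gcd[cm,cn] g u (v * n) ⟨
    g * gcd u (v * n)                                 ≡⟨ cong (g *_) (gcd[m,k*n]≡gcd[m,n] n u⊥v) ⟩
    g * gcd u n                                       ≡⟨ cong (g *_) (trans (gcd-comm u n) n⊓u≡n⊓g) ⟩
    g * gcd n g                                       ≡⟨ *-comm g (gcd n g) ⟩
    gcd n g * g                                       ≡⟨ cong₂ _*_ (cong (gcd n) gu⊓gv≡g) gu⊓gv≡g ⟨
    gcd n (gcd (g * u) (g * v)) * gcd (g * u) (g * v) ≡⟨ cong (_* gcd (g * u) (g * v)) (gcd-assoc n (g * u) (g * v)) ⟨
    gcd (gcd n (g * u)) (g * v) * gcd (g * u) (g * v) ∎
    where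
    open ≡-Reasoning
    gu⊓gv≡g : gcd (g * u) (g * v) ≡ g
    gu⊓gv≡g = trans (sym (c*gcd[m,n]≡gcd[cm,cn] g u v)) (trans (cong (g *_) (coprime⇒gcd≡1 u⊥v)) (*-identityʳ g))

  ¬∣⇒coprime : ∀ {p n} → Prime p → ¬ p ∣ n → Coprime p n
  ¬∣⇒coprime pr p∤n (d∣p , d∣n) with prime⇒irreducible pr d∣p
  ... | inj₁ d≡1 = d≡1
  ... | inj₂ refl = contradiction d∣n p∤n

  coprime-^ : ∀ {m n} → Coprime m n → ∀ i → Coprime (m ^ i) n
  coprime-^ m⊥n zero (d∣1 , _) = ∣1⇒≡1 d∣1
  coprime-^ {m} {n} m⊥n (suc i) {d} (d∣m*mⁱ , d∣n) = coprime-^ m⊥n i (coprime-divisor d⊥m d∣m*mⁱ , d∣n)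
    where
    d⊥m : Coprime d m
    d⊥m (e∣d , e∣m) = m⊥n (e∣m , ∣-trans e∣d d∣n)

  p^i∣m*n⇒p^i∣m : ∀ {p m n} i → Prime p → ¬ p ∣ n → p ^ i ∣ m * n → p ^ i ∣ m
  p^i∣m*n⇒p^i∣m {p} {m} {n} i pr p∤n h =
    coprime-divisor (coprime-^ (¬∣⇒coprime pr p∤n) i) (subst (p ^ i ∣_) (*-comm m n) h)

  prime∣*⇒∣ : ∀ {p m n} → Prime p → ¬ p ∣ m → p ∣ m * n → p ∣ n
  prime∣*⇒∣ {m = m} {n} pr p∤m p∣mn with euclidsLemma m n pr p∣mn
  ... | inj₁ p∣m = contradiction p∣m p∤m
  ... | inj₂ p∣n = p∣n

  prime∣square⇒∣ : ∀ {p} x → Prime p → p ∣ x * x → p ∣ x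
  prime∣square⇒∣ x pr p∣xx with euclidsLemma x x pr p∣xx
  ... | inj₁ p∣x = p∣x
  ... | inj₂ p∣x = p∣x

  -- If p ∣ d then p divides n and m as well; cancelling p from n, m and d reduces n.
  ∣n∣p*m⇒∣m : ∀ {p} → Prime p → ∀ {n m d} → Acc _<_ n → .{{NonZero n}} →
    (∀ i → p ^ i ∣ n → p ^ i ∣ m) → d ∣ n → d ∣ p * m → d ∣ m
  ∣n∣p*m⇒∣m {p} pr {n} {m} {d} (acc smaller) p-part d∣n d∣pm with p ∣? d
  ... | no p∤d = coprime-divisor (Coprime.sym (¬∣⇒coprime pr p∤d)) d∣pm
  ... | yes p∣d with p∣d | ∣-trans p∣d d∣n
                   | subst (_∣ m) (^-identityʳ p) (p-part 1 (subst (_∣ n) (sym (^-identityʳ p)) (∣-trans p∣d d∣n)))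
  ...   | divides d′ refl | divides n′ refl | divides m′ refl =
    *-monoˡ-∣ p (∣n∣p*m⇒∣m pr (smaller n′<n) p-part′ (*-cancelʳ-∣ p d∣n) d′∣p*m′)
    where
    instance
      p≢0 : NonZero p
      p≢0 = prime⇒nonZero pr
      n′≢0 : NonZero n′
      n′≢0 = m*n≢0⇒m≢0 n′
    n′<n : n′ < n′ * p
    n′<n = m<m*n n′ p (nonTrivial⇒n>1 p {{prime⇒nonTrivial pr}})
    p-part′ : ∀ i → p ^ i ∣ n′ → p ^ i ∣ m′
    p-part′ i h = *-cancelʳ-∣ p (subst (_∣ m′ * p) (*-comm p (p ^ i))
      (p-part (suc i) (subst (_∣ n′ * p) (*-comm (p ^ i) p) (*-monoˡ-∣ p h))))
    d′∣p*m′ : d′ ∣ p * m′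
    d′∣p*m′ = *-cancelʳ-∣ p (subst (d′ * p ∣_) (sym (*-assoc p m′ p)) d∣pm)

  gcd[n,p*m]≡gcd[n,m] : ∀ {p n} m → Prime p → .{{NonZero n}} → (∀ i → p ^ i ∣ n → p ^ i ∣ m) →
    gcd n (p * m) ≡ gcd n m
  gcd[n,p*m]≡gcd[n,m] {p} {n} m pr p-part = ∣-antisym
    (gcd-greatest (gcd[m,n]∣m n (p * m))
      (∣n∣p*m⇒∣m pr (<-wellFounded n) p-part (gcd[m,n]∣m n (p * m)) (gcd[m,n]∣n n (p * m))))
    (gcd-greatest (gcd[m,n]∣m n m) (∣n⇒∣m*n p (gcd[m,n]∣n n m)))

  prime[3] : Prime 3
  prime[3] = from-yes (prime? 3)

  prime[7] : Prime 7
  prime[7] = from-yes (prime? 7)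

  odd∣4⇒≡1 : ∀ {d} → ¬ 2 ∣ d → d ∣ 4 → d ≡ 1
  odd∣4⇒≡1 {d} 2∤d d∣4 = ∣1⇒≡1 (coprime-divisor d⊥2 (coprime-divisor d⊥2 d∣4))
    where
    d⊥2 : Coprime d 2
    d⊥2 = Coprime.sym (¬∣⇒coprime prime[2] 2∤d)

  odd⊥4 : ∀ {n} → ¬ 2 ∣ n → Coprime n 4
  odd⊥4 2∤n = Coprime.sym (coprime-^ (¬∣⇒coprime prime[2] 2∤n) 2)

  odd⇒nonZero : ∀ {n} → ¬ 2 ∣ n → NonZero n
  odd⇒nonZero {zero} 2∤0 = contradiction (2 ∣0) 2∤0
  odd⇒nonZero {suc n} _ = _

  7b²≡3a²+4⇒3∤b : ∀ a {b} → 7 * (b * b) ≡ 3 * (a * a) + 4 → ¬ 3 ∣ b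
  7b²≡3a²+4⇒3∤b a {b} pell 3∣b = from-no (3 ∣? 4)
    (∣m+n∣m⇒∣n (subst (3 ∣_) pell (∣n⇒∣m*n 7 (∣m⇒∣m*n b 3∣b))) (m∣m*n (a * a)))

  d²≡21c²+4⇒p∤d : ∀ {p} c {d} → p ∣ 21 → ¬ p ∣ 4 → d * d ≡ 21 * (c * c) + 4 → ¬ p ∣ d
  d²≡21c²+4⇒p∤d {p} c {d} p∣21 p∤4 pell p∣d =
    p∤4 (∣m+n∣m⇒∣n (subst (p ∣_) pell (∣m⇒∣m*n d p∣d)) (∣m⇒∣m*n (c * c) p∣21))

  gcd-identity-odd-coprime : ∀ {n} a b → ¬ 2 ∣ n → ¬ 2 ∣ b → 7 * (b * b) ≡ 3 * (a * a) + 4 →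
    (∀ i → 3 ^ i ∣ n → 3 ^ i ∣ a) → GcdIdentity n (3 * (a * a)) (a * b)
  gcd-identity-odd-coprime {n} a b 2∤n 2∤b pell 3-part =
    gcd-identity-by-cofactors n a (3 * a) b U≡a*3a refl 3a⊥b (gcd[n,p*m]≡gcd[n,m] a prime[3] 3-part)
    where
    instance
      n≢0 : NonZero n
      n≢0 = odd⇒nonZero 2∤n
    U≡a*3a : 3 * (a * a) ≡ a * (3 * a)
    U≡a*3a = solve (a ∷ [])
    3a⊥b : Coprime (3 * a) b
    3a⊥b {e} (e∣3a , e∣b) = odd∣4⇒≡1 (λ 2∣e → 2∤b (∣-trans 2∣e e∣b))
      (∣m+n∣m⇒∣n (subst (e ∣_) pell (∣n⇒∣m*n 7 (∣m⇒∣m*n b e∣b))) (subst (e ∣_) (*-assoc 3 a a) (∣m⇒∣m*n a e∣3a)))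

  gcd-identity-odd-halved : ∀ {n} a b → ¬ 2 ∣ n → 7 * (b * b) ≡ 3 * (a * a) + 1 →
    (∀ i → 3 ^ i ∣ n → 3 ^ i ∣ a) → GcdIdentity n (3 * ((a * 2) * (a * 2))) ((a * 2) * (b * 2))
  gcd-identity-odd-halved {n} a b 2∤n pell 3-part =
    gcd-identity-by-cofactors n (4 * a) (3 * a) b U≡4a*3a V≡4a*b 3a⊥b
      (trans (gcd[n,p*m]≡gcd[n,m] a prime[3] 3-part) (sym (gcd[m,k*n]≡gcd[m,n] a (odd⊥4 2∤n))))
    where
    instance
      n≢0 : NonZero n
      n≢0 = odd⇒nonZero 2∤n
    U≡4a*3a : 3 * ((a * 2) * (a * 2)) ≡ 4 * a * (3 * a)
    U≡4a*3a = solve (a ∷ [])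
    V≡4a*b : (a * 2) * (b * 2) ≡ 4 * a * b
    V≡4a*b = solve (a ∷ b ∷ [])
    3a⊥b : Coprime (3 * a) b
    3a⊥b {e} (e∣3a , e∣b) = ∣1⇒≡1
      (∣m+n∣m⇒∣n (subst (e ∣_) pell (∣n⇒∣m*n 7 (∣m⇒∣m*n b e∣b))) (subst (e ∣_) (*-assoc 3 a a) (∣m⇒∣m*n a e∣3a)))

  gcd-identity-odd : ∀ {n} a b → ¬ 2 ∣ n → 7 * (b * b) ≡ 3 * (a * a) + 4 →
    (∀ i → 3 ^ i ∣ n → 3 ^ i ∣ a * b) → GcdIdentity n (3 * (a * a)) (a * b)
  gcd-identity-odd {n} a b 2∤n pell 3-part with 2 ∣? b
  ... | no 2∤b = gcd-identity-odd-coprime a b 2∤n 2∤b pell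
    (λ i 3ⁱ∣n → p^i∣m*n⇒p^i∣m i prime[3] (7b²≡3a²+4⇒3∤b a pell) (3-part i 3ⁱ∣n))
  ... | yes (divides b₁ refl) with prime∣square⇒∣ a prime[2] (prime∣*⇒∣ prime[2] (from-no (2 ∣? 3)) 2∣3a²)
    where
    2∣3a² : 2 ∣ 3 * (a * a)
    2∣3a² = ∣m+n∣m⇒∣n (subst (2 ∣_) (trans pell (+-comm _ 4)) (∣n⇒∣m*n 7 (∣m⇒∣m*n (b₁ * 2) (n∣m*n b₁))))
      (divides 2 refl)
  ...   | divides a₁ refl = gcd-identity-odd-halved a₁ b₁ 2∤n pell₁ 3-part₁
    where
    pell₁ : 7 * (b₁ * b₁) ≡ 3 * (a₁ * a₁) + 1
    pell₁ = *-cancelˡ-≡ (7 * (b₁ * b₁)) (3 * (a₁ * a₁) + 1) 4 (begin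
      4 * (7 * (b₁ * b₁))               ≡⟨ solve (b₁ ∷ []) ⟩
      7 * ((b₁ * 2) * (b₁ * 2))         ≡⟨ pell ⟩
      3 * ((a₁ * 2) * (a₁ * 2)) + 4     ≡⟨ solve (a₁ ∷ []) ⟩
      4 * (3 * (a₁ * a₁) + 1)           ∎)
      where open ≡-Reasoning
    3-part₁ : ∀ i → 3 ^ i ∣ n → 3 ^ i ∣ a₁
    3-part₁ i 3ⁱ∣n = p^i∣m*n⇒p^i∣m i prime[3] (from-no (3 ∣? 2))
      (p^i∣m*n⇒p^i∣m i prime[3] (7b²≡3a²+4⇒3∤b (a₁ * 2) pell) (3-part i 3ⁱ∣n))

  gcd-identity-even-coprime : ∀ {n} c d → .{{NonZero n}} → ¬ 2 ∣ c → d * d ≡ 21 * (c * c) + 4 →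
    (∀ i → 3 ^ i ∣ n → 3 ^ i ∣ c) → (∀ i → 7 ^ i ∣ n → 7 ^ i ∣ c) → GcdIdentity n (21 * (c * c)) (c * d)
  gcd-identity-even-coprime {n} c d 2∤c pell 3-part 7-part =
    gcd-identity-by-cofactors n c (3 * (7 * c)) d U≡c*21c refl 21c⊥d (begin
      gcd n (3 * (7 * c)) ≡⟨ gcd[n,p*m]≡gcd[n,m] (7 * c) prime[3] (λ i 3ⁱ∣n → ∣n⇒∣m*n 7 (3-part i 3ⁱ∣n)) ⟩
      gcd n (7 * c)       ≡⟨ gcd[n,p*m]≡gcd[n,m] c prime[7] 7-part ⟩
      gcd n c             ∎)
    where
    open ≡-Reasoning
    U≡c*21c : 21 * (c * c) ≡ c * (3 * (7 * c))
    U≡c*21c = solve (c ∷ [])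
    21c*c≡21c² : 3 * (7 * c) * c ≡ 21 * (c * c)
    21c*c≡21c² = solve (c ∷ [])
    2∤d : ¬ 2 ∣ d
    2∤d 2∣d = 2∤c (prime∣square⇒∣ c prime[2] (prime∣*⇒∣ prime[2] (from-no (2 ∣? 21))
      (∣m+n∣m⇒∣n (subst (2 ∣_) (trans pell (+-comm _ 4)) (∣m⇒∣m*n d 2∣d)) (divides 2 refl))))
    21c⊥d : Coprime (3 * (7 * c)) d
    21c⊥d {e} (e∣21c , e∣d) = odd∣4⇒≡1 (λ 2∣e → 2∤d (∣-trans 2∣e e∣d))
      (∣m+n∣m⇒∣n (subst (e ∣_) pell (∣m⇒∣m*n d e∣d)) (subst (e ∣_) 21c*c≡21c² (∣m⇒∣m*n c e∣21c)))

  gcd-identity-even-halved : ∀ {n} w {d} → .{{NonZero n}} → 2 ∣ d → d * d ≡ 21 * ((w * 4) * (w * 4)) + 4 →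
    (∀ i → 3 ^ i ∣ n → 3 ^ i ∣ 2 * w) → (∀ i → 7 ^ i ∣ n → 7 ^ i ∣ 2 * w) → (∀ i → 2 ^ i ∣ n → 2 ^ i ∣ 2 * w) →
    GcdIdentity n (21 * ((w * 4) * (w * 4))) ((w * 4) * d)
  gcd-identity-even-halved {n} w (divides d refl) pell 3-part 7-part 2-part =
    gcd-identity-by-cofactors n (8 * w) (3 * (7 * (2 * w))) d U≡8w*42w V≡8w*d 42w⊥d (begin
      gcd n (3 * (7 * (2 * w)))   ≡⟨ gcd[n,p*m]≡gcd[n,m] (7 * (2 * w)) prime[3] (λ i 3ⁱ∣n → ∣n⇒∣m*n 7 (3-part i 3ⁱ∣n)) ⟩
      gcd n (7 * (2 * w))         ≡⟨ gcd[n,p*m]≡gcd[n,m] (2 * w) prime[7] 7-part ⟩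
      gcd n (2 * w)               ≡⟨ gcd[n,p*m]≡gcd[n,m] (2 * w) prime[2] 2-part ⟨
      gcd n (2 * (2 * w))         ≡⟨ gcd[n,p*m]≡gcd[n,m] (2 * (2 * w)) prime[2] (λ i 2ⁱ∣n → ∣n⇒∣m*n 2 (2-part i 2ⁱ∣n)) ⟨
      gcd n (2 * (2 * (2 * w)))   ≡⟨ cong (gcd n) (solve (w ∷ [])) ⟩
      gcd n (8 * w)               ∎)
    where
    open ≡-Reasoning
    U≡8w*42w : 21 * ((w * 4) * (w * 4)) ≡ 8 * w * (3 * (7 * (2 * w)))
    U≡8w*42w = solve (w ∷ [])
    V≡8w*d : (w * 4) * (d * 2) ≡ 8 * w * d
    V≡8w*d = solve (w ∷ d ∷ [])
    pell′ : d * d ≡ 84 * (w * w) + 1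
    pell′ = *-cancelˡ-≡ (d * d) (84 * (w * w) + 1) 4 (begin
      4 * (d * d)                       ≡⟨ solve (d ∷ []) ⟩
      (d * 2) * (d * 2)                 ≡⟨ pell ⟩
      21 * ((w * 4) * (w * 4)) + 4      ≡⟨ solve (w ∷ []) ⟩
      4 * (84 * (w * w) + 1)            ∎)
    42w*2w≡84w² : 3 * (7 * (2 * w)) * (2 * w) ≡ 84 * (w * w)
    42w*2w≡84w² = solve (w ∷ [])
    42w⊥d : Coprime (3 * (7 * (2 * w))) d
    42w⊥d {e} (e∣42w , e∣d) = ∣1⇒≡1
      (∣m+n∣m⇒∣n (subst (e ∣_) pell′ (∣m⇒∣m*n d e∣d)) (subst (e ∣_) 42w*2w≡84w² (∣m⇒∣m*n (2 * w) e∣42w)))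

  gcd-identity-even : ∀ {n} c d → .{{NonZero n}} → 2 ∣ n → d * d ≡ 21 * (c * c) + 4 →
    (∀ i → 3 ^ i ∣ n → 3 ^ i ∣ c * d) → (∀ i → 7 ^ i ∣ n → 7 ^ i ∣ c * d) →
    (2 ∣ c → ∀ i → 2 ^ i ∣ n → 2 ^ suc i ∣ c) → GcdIdentity n (21 * (c * c)) (c * d)
  gcd-identity-even {n} c d 2∣n pell 3-part 7-part 2-part with 2 ∣? c
  ... | no 2∤c = gcd-identity-even-coprime c d 2∤c pell
    (odd-part prime[3] (divides 7 refl) (from-no (3 ∣? 4)) 3-part)
    (odd-part prime[7] (divides 3 refl) (from-no (7 ∣? 4)) 7-part)
    where
    odd-part : ∀ {p} → Prime p → p ∣ 21 → ¬ p ∣ 4 → (∀ i → p ^ i ∣ n → p ^ i ∣ c * d) →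
      ∀ i → p ^ i ∣ n → p ^ i ∣ c
    odd-part pr p∣21 p∤4 p-part i pⁱ∣n = p^i∣m*n⇒p^i∣m i pr (d²≡21c²+4⇒p∤d c p∣21 p∤4 pell) (p-part i pⁱ∣n)
  ... | yes 2∣c with 2-part 2∣c 1 (subst (_∣ n) (sym (*-identityʳ 2)) 2∣n)
  ...   | divides w refl = gcd-identity-even-halved w 2∣d pell
    (halve prime[3] (divides 7 refl) (from-no (3 ∣? 2)) (from-no (3 ∣? 4)) 3-part)
    (halve prime[7] (divides 3 refl) (from-no (7 ∣? 2)) (from-no (7 ∣? 4)) 7-part)
    (λ i 2ⁱ∣n → *-cancelˡ-∣ 2 (subst (2 * 2 ^ i ∣_) w*4≡2*2w (2-part 2∣c i 2ⁱ∣n)))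
    where
    w*4≡2*2w : w * 4 ≡ 2 * (2 * w)
    w*4≡2*2w = solve (w ∷ [])
    2∣d : 2 ∣ d
    2∣d = prime∣square⇒∣ d prime[2]
      (subst (2 ∣_) (sym pell) (∣m∣n⇒∣m+n (∣n⇒∣m*n 21 (∣m⇒∣m*n (w * 4) (∣n⇒∣m*n w (divides 2 refl)))) (divides 2 refl)))
    halve : ∀ {p} → Prime p → p ∣ 21 → ¬ p ∣ 2 → ¬ p ∣ 4 → (∀ i → p ^ i ∣ n → p ^ i ∣ (w * 4) * d) →
      ∀ i → p ^ i ∣ n → p ^ i ∣ 2 * w
    halve {p} pr p∣21 p∤2 p∤4 p-part i pⁱ∣n =
      p^i∣m*n⇒p^i∣m i pr p∤2 (subst (p ^ i ∣_) (trans w*4≡2*2w (*-comm 2 (2 * w)))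
        (p^i∣m*n⇒p^i∣m i pr (d²≡21c²+4⇒p∤d (w * 4) p∣21 p∤4 pell) (p-part i pⁱ∣n)))

-- The sequences W, F and L
module _ where
  open import Data.Integer using (_+_; _-_; _*_)
  import Data.Integer.Properties as ℤ
  open import Data.Integer.Divisibility.Signed using (_∣_; ∣-refl; ∣m∣n⇒∣m-n; ∣m⇒∣m*n; ∣n⇒∣m*n; ∣m+n∣n⇒∣m; ∣⇒∣ᵤ)
  open import Data.Integer.Tactic.RingSolver using (solve; solve-∀)
  import Data.Nat as ℕ
  import Data.Nat.Properties as ℕ
  import Data.Nat.Divisibility as ℕ

  -- W c k = U_{k-1}(c/2); thus F k = U_{k-1}(5/2), and L k = 2 T_k(5/2).
  W : ℤ → ℕ → ℤ
  W c zero = + 0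
  W c (suc zero) = + 1
  W c (suc (suc k)) = c * W c (suc k) - W c k

  F : ℕ → ℤ
  F = W (+ 5)

  L : ℕ → ℤ
  L zero = + 2
  L (suc zero) = + 5
  L (suc (suc k)) = + 5 * L (suc k) - L k

  Recurrent : ℤ → (ℕ → ℤ) → Set
  Recurrent c s = ∀ k → s (suc (suc k)) ≡ c * s (suc k) - s k

  module _ {c : ℤ} {s : ℕ → ℤ} (rec : Recurrent c s) where

    recurrent-basis : ∀ k → s k ≡ s 0 * W c (suc k) + (s 1 - c * s 0) * W c k
    recurrent-basis zero = at-0 (s 0) (s 1) c
      where
      at-0 : ∀ a b c → a ≡ a * + 1 + (b - c * a) * + 0
      at-0 = solve-∀
    recurrent-basis (suc zero) = at-1 (s 0) (s 1) c
      where
      at-1 : ∀ a b c → b ≡ a * (c * + 1 - + 0) + (b - c * a) * + 1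
      at-1 = solve-∀
    recurrent-basis (suc (suc k)) = begin
      s (2 ℕ.+ k)
        ≡⟨ rec k ⟩
      c * s (suc k) - s k
        ≡⟨ cong₂ (λ p q → c * p - q) (recurrent-basis (suc k)) (recurrent-basis k) ⟩
      c * (s 0 * W c (2 ℕ.+ k) + b * W c (suc k)) - (s 0 * W c (suc k) + b * W c k)
        ≡⟨ combination (s 0) b c (W c k) (W c (suc k)) (W c (2 ℕ.+ k)) ⟩
      s 0 * W c (3 ℕ.+ k) + b * W c (2 ℕ.+ k)
        ∎
      where
      open ≡-Reasoning
      b : ℤ
      b = s 1 - c * s 0
      combination : ∀ a b c w₀ w₁ w₂ →
        c * (a * w₂ + b * w₁) - (a * w₁ + b * w₀) ≡ a * (c * w₂ - w₁) + b * (c * w₁ - w₀)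
      combination = solve-∀

  W-+ : ∀ {c} m n → W c (m ℕ.+ n) ≡ W c n * W c (suc m) + (W c (suc n) - c * W c n) * W c m
  W-+ {c} m n = recurrent-basis {c} {λ k → W c (k ℕ.+ n)} (λ _ → refl) m

  W-double-suc : ∀ c k → W c (suc (k ℕ.+ k)) ≡ W c (suc k) * W c (suc k) - W c k * W c k
  W-double-suc c k = trans (W-+ (suc k) k) (regroup c (W c k) (W c (suc k)))
    where
    regroup : ∀ c x y → x * (c * y - x) + (y - c * x) * y ≡ y * y - x * x
    regroup = solve-∀

  L≡2F-5F : ∀ k → L k ≡ + 2 * F (suc k) - + 5 * F k
  L≡2F-5F k = trans (recurrent-basis {s = L} (λ _ → refl) k) (simplify (F (suc k)) (F k))
    where
    simplify : ∀ y x → + 2 * y + (+ 5 - + 5 * + 2) * x ≡ + 2 * y - + 5 * x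
    simplify = solve-∀

  cassini : ∀ k → F (suc k) * F (suc k) - + 5 * F k * F (suc k) + F k * F k ≡ + 1
  cassini zero = refl
  cassini (suc k) = trans (invariance (F k) (F (suc k))) (cassini k)
    where
    invariance : ∀ x y →
      (+ 5 * y - x) * (+ 5 * y - x) - + 5 * y * (+ 5 * y - x) + y * y ≡ y * y - + 5 * x * y + x * x
    invariance = solve-∀

  module CassiniIdentities (x y : ℤ) (cassini-xy : y * y - + 5 * x * y + x * x ≡ + 1) where

    by-cassini : ∀ {lhs} c p → lhs ≡ p + c * (y * y - + 5 * x * y + x * x - + 1) → lhs ≡ p
    by-cassini {lhs} c p eq = begin
      lhs                                          ≡⟨ eq ⟩
      p + c * (y * y - + 5 * x * y + x * x - + 1) ≡⟨ cong (λ q → p + c * (q - + 1)) cassini-xy ⟩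
      p + c * + 0                                  ≡⟨ cong (λ z → p + z) (ℤ.*-zeroʳ c) ⟩
      p + + 0                                      ≡⟨ ℤ.+-identityʳ p ⟩
      p                                            ∎
      where open ≡-Reasoning

    L-sq : (+ 2 * y - + 5 * x) * (+ 2 * y - + 5 * x) ≡ + 21 * (x * x) + + 4
    L-sq = by-cassini (+ 4) _ (solve (x ∷ y ∷ []))

    odd-pell : + 7 * ((y - x) * (y - x)) ≡ + 3 * ((x + y) * (x + y)) + + 4
    odd-pell = by-cassini (+ 4) _ (solve (x ∷ y ∷ []))

    L-double : - + 2 + (+ 2 * ((x + y) * (y - x)) - + 5 * (x * y + (y - + 5 * x) * x)) ≡ + 21 * (x * x)
    L-double = by-cassini (+ 2) _ (solve (x ∷ y ∷ []))

    L-double-suc : - + 2 + (+ 2 * (y * (+ 5 * y - x) + ((+ 5 * y - x) - + 5 * y) * y) - + 5 * ((x + y) * (y - x)))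
                   ≡ + 3 * ((x + y) * (x + y))
    L-double-suc = by-cassini (+ 2) _ (solve (x ∷ y ∷ []))

    shift : ∀ X Y →
      (X * y + (Y - + 5 * X) * x) * y + (X * (+ 5 * y - x) + (Y - + 5 * X) * y - + 5 * (X * y + (Y - + 5 * X) * x)) * x
        ≡ (+ 2 * y - + 5 * x) * (X * y + (Y - + 5 * X) * x) - X
    shift X Y = by-cassini (- X) _ (solve (x ∷ y ∷ X ∷ Y ∷ []))

  module AtIndex (k : ℕ) = CassiniIdentities (F k) (F (suc k)) (cassini k)

  F-double : ∀ k → F (k ℕ.+ k) ≡ F k * L k
  F-double k = begin
    F (k ℕ.+ k)                                      ≡⟨ W-+ k k ⟩
    F k * F (suc k) + (F (suc k) - + 5 * F k) * F k  ≡⟨ regroup (F k) (F (suc k)) ⟩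
    F k * (+ 2 * F (suc k) - + 5 * F k)              ≡⟨ cong (F k *_) (sym (L≡2F-5F k)) ⟩
    F k * L k                                        ∎
    where
    open ≡-Reasoning
    regroup : ∀ x y → x * y + (y - + 5 * x) * x ≡ x * (+ 2 * y - + 5 * x)
    regroup = solve-∀

  F-double-suc : ∀ k → F (suc (k ℕ.+ k)) ≡ (F k + F (suc k)) * (F (suc k) - F k)
  F-double-suc k = trans (W-double-suc (+ 5) k) (difference-of-squares (F k) (F (suc k)))
    where
    difference-of-squares : ∀ x y → y * y - x * x ≡ (x + y) * (y - x)
    difference-of-squares = solve-∀

  L-sq : ∀ k → L k * L k ≡ + 21 * (F k * F k) + + 4
  L-sq k = trans (cong (λ l → l * l) (L≡2F-5F k)) (AtIndex.L-sq k)

  odd-pell : ∀ k → + 7 * ((F (suc k) - F k) * (F (suc k) - F k)) ≡ + 3 * ((F k + F (suc k)) * (F k + F (suc k))) + + 4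
  odd-pell k = AtIndex.odd-pell k

  L-double : ∀ k → - + 2 + L (k ℕ.+ k) ≡ + 21 * (F k * F k)
  L-double k = begin
    - + 2 + L (k ℕ.+ k)
      ≡⟨ cong (λ l → - + 2 + l) (L≡2F-5F (k ℕ.+ k)) ⟩
    - + 2 + (+ 2 * F (suc (k ℕ.+ k)) - + 5 * F (k ℕ.+ k))
      ≡⟨ cong₂ (λ p q → - + 2 + (+ 2 * p - + 5 * q)) (F-double-suc k) (W-+ k k) ⟩
    - + 2 + (+ 2 * ((x + y) * (y - x)) - + 5 * (x * y + (y - + 5 * x) * x))
      ≡⟨ AtIndex.L-double k ⟩
    + 21 * (x * x)
      ∎
    where
    open ≡-Reasoning
    x y : ℤ
    x = F k
    y = F (suc k)

  L-double-suc : ∀ k → - + 2 + L (suc (k ℕ.+ k)) ≡ + 3 * ((F k + F (suc k)) * (F k + F (suc k)))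
  L-double-suc k = begin
    - + 2 + L (suc (k ℕ.+ k))
      ≡⟨ cong (λ l → - + 2 + l) (L≡2F-5F (suc (k ℕ.+ k))) ⟩
    - + 2 + (+ 2 * F (2 ℕ.+ (k ℕ.+ k)) - + 5 * F (suc (k ℕ.+ k)))
      ≡⟨ cong₂ (λ p q → - + 2 + (+ 2 * p - + 5 * q)) F[2k+2] (F-double-suc k) ⟩
    - + 2 + (+ 2 * (y * (+ 5 * y - x) + ((+ 5 * y - x) - + 5 * y) * y) - + 5 * ((x + y) * (y - x)))
      ≡⟨ AtIndex.L-double-suc k ⟩
    + 3 * ((x + y) * (x + y))
      ∎
    where
    open ≡-Reasoning
    x y : ℤ
    x = F k
    y = F (suc k)
    F[2k+2] : F (2 ℕ.+ (k ℕ.+ k)) ≡ y * (+ 5 * y - x) + ((+ 5 * y - x) - + 5 * y) * y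
    F[2k+2] = trans (cong (λ i → F (suc i)) (sym (ℕ.+-suc k k))) (W-+ (suc k) (suc k))

  F-shift : ∀ M a → F (M ℕ.+ (M ℕ.+ a)) ≡ L M * F (M ℕ.+ a) - F a
  F-shift M a = begin
    F (M ℕ.+ (M ℕ.+ a))
      ≡⟨ W-+ M (M ℕ.+ a) ⟩
    F (M ℕ.+ a) * y + (F (suc M ℕ.+ a) - + 5 * F (M ℕ.+ a)) * x
      ≡⟨ cong₂ (λ p q → p * y + (q - + 5 * p) * x) (W-+ M a) (W-+ (suc M) a) ⟩
    (X * y + (Y - + 5 * X) * x) * y + (X * (+ 5 * y - x) + (Y - + 5 * X) * y - + 5 * (X * y + (Y - + 5 * X) * x)) * x
      ≡⟨ AtIndex.shift M X Y ⟩
    (+ 2 * y - + 5 * x) * (X * y + (Y - + 5 * X) * x) - X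
      ≡⟨ cong₂ (λ l p → l * p - X) (sym (L≡2F-5F M)) (sym (W-+ M a)) ⟩
    L M * F (M ℕ.+ a) - F a
      ∎
    where
    open ≡-Reasoning
    x y X Y : ℤ
    x = F M
    y = F (suc M)
    X = F a
    Y = F (suc a)

  F-* : ∀ j M → F (j ℕ.* M) ≡ F M * W (L M) j
  F-* j M = begin
    F (j ℕ.* M)
      ≡⟨ recurrent-basis {s = λ i → F (i ℕ.* M)} (λ i → F-shift M (i ℕ.* M)) j ⟩
    + 0 * W (L M) (suc j) + (F (M ℕ.+ 0) - L M * + 0) * W (L M) j
      ≡⟨ cong (λ i → + 0 * W (L M) (suc j) + (F i - L M * + 0) * W (L M) j) (ℕ.+-identityʳ M) ⟩
    + 0 * W (L M) (suc j) + (F M - L M * + 0) * W (L M) j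
      ≡⟨ simplify (W (L M) (suc j)) (F M) (L M) (W (L M) j) ⟩
    F M * W (L M) j
      ∎
    where
    open ≡-Reasoning
    simplify : ∀ w₁ x l w₀ → + 0 * w₁ + (x - l * + 0) * w₀ ≡ x * w₀
    simplify = solve-∀

  W-2 : ∀ ℓ → W ℓ 2 ≡ ℓ
  W-2 ℓ = trans (ℤ.+-identityʳ (ℓ * + 1)) (ℤ.*-identityʳ ℓ)

  W-3 : ∀ ℓ → W ℓ 3 ≡ ℓ * ℓ - + 1
  W-3 ℓ = cong (λ w → ℓ * w - + 1) (W-2 ℓ)

  W-4 : ∀ ℓ → W ℓ 4 ≡ ℓ * (ℓ * ℓ - + 1) - ℓ
  W-4 ℓ = cong₂ (λ p q → ℓ * p - q) (W-3 ℓ) (W-2 ℓ)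

  W-3-pell : ∀ ℓ s → ℓ * ℓ ≡ + 21 * s + + 4 → W ℓ 3 ≡ + 3 * (+ 7 * s + + 1)
  W-3-pell ℓ s eq = begin
    W ℓ 3                   ≡⟨ W-3 ℓ ⟩
    ℓ * ℓ - + 1             ≡⟨ cong (λ t → t - + 1) eq ⟩
    + 21 * s + + 4 - + 1    ≡⟨ solve (s ∷ []) ⟩
    + 3 * (+ 7 * s + + 1)   ∎
    where open ≡-Reasoning

  W-7-pell : ∀ ℓ s → ℓ * ℓ ≡ + 21 * s + + 4 →
    W ℓ 7 ≡ + 7 * (+ 1323 * (s * s * s) + + 441 * (s * s) + + 42 * s + + 1)
  W-7-pell ℓ s eq = begin
    W ℓ 7
      ≡⟨ W-double-suc ℓ 3 ⟩
    W ℓ 4 * W ℓ 4 - W ℓ 3 * W ℓ 3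
      ≡⟨ cong₂ (λ p q → p * p - q * q) (W-4 ℓ) (W-3 ℓ) ⟩
    (ℓ * (ℓ * ℓ - + 1) - ℓ) * (ℓ * (ℓ * ℓ - + 1) - ℓ) - (ℓ * ℓ - + 1) * (ℓ * ℓ - + 1)
      ≡⟨ solve (ℓ ∷ []) ⟩
    (ℓ * ℓ) * (ℓ * ℓ) * (ℓ * ℓ) - + 5 * ((ℓ * ℓ) * (ℓ * ℓ)) + + 6 * (ℓ * ℓ) - + 1
      ≡⟨ cong (λ t → t * t * t - + 5 * (t * t) + + 6 * t - + 1) eq ⟩
    (+ 21 * s + + 4) * (+ 21 * s + + 4) * (+ 21 * s + + 4) - + 5 * ((+ 21 * s + + 4) * (+ 21 * s + + 4))
      + + 6 * (+ 21 * s + + 4) - + 1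
      ≡⟨ solve (s ∷ []) ⟩
    + 7 * (+ 1323 * (s * s * s) + + 441 * (s * s) + + 42 * s + + 1)
      ∎
    where open ≡-Reasoning

  F-period-mod-2 : ∀ k → F (3 ℕ.+ k) ≡ F k + + 2 * (+ 12 * F (suc k) - + 3 * F k)
  F-period-mod-2 k = unfold (F k) (F (suc k))
    where
    unfold : ∀ x y → + 5 * (+ 5 * y - x) - y ≡ x + + 2 * (+ 12 * y - + 3 * x)
    unfold = solve-∀

  2∣F⇒2∣L : ∀ m → + 2 ∣ F m → + 2 ∣ L m
  2∣F⇒2∣L m 2∣F =
    subst (+ 2 ∣_) (sym (L≡2F-5F m)) (∣m∣n⇒∣m-n (∣m⇒∣m*n (F (suc m)) ∣-refl) (∣n⇒∣m*n (+ 5) 2∣F))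

  2∣F⇒3∣ : ∀ k → + 2 ∣ F k → 3 ℕ.∣ k
  2∣F⇒3∣ zero _ = ℕ.divides 0 refl
  2∣F⇒3∣ (suc zero) 2∣1 = contradiction (∣⇒∣ᵤ 2∣1) (from-no (2 ℕ.∣? 1))
  2∣F⇒3∣ (suc (suc zero)) 2∣5 = contradiction (∣⇒∣ᵤ 2∣5) (from-no (2 ℕ.∣? 5))
  2∣F⇒3∣ (suc (suc (suc k))) 2∣F = ℕ.∣m∣n⇒∣m+n ℕ.∣-refl (2∣F⇒3∣ k 2∣Fk)
    where
    2∣Fk : + 2 ∣ F k
    2∣Fk = ∣m+n∣n⇒∣m (subst (+ 2 ∣_) (F-period-mod-2 k) 2∣F) (∣m⇒∣m*n _ ∣-refl)

-- Prime power divisors of F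
module _ where
  open import Data.Nat using (_+_; _*_; _^_)
  open import Data.Nat.Properties using (*-comm; *-assoc; *-identityʳ; +-identityʳ)
  open import Data.Nat.Divisibility
  open import Data.Nat.Tactic.RingSolver using (solve-∀)
  open import Data.Nat.Primality using (prime[2])
  import Data.Integer as ℤ
  import Data.Integer.Properties as ℤ
  import Data.Integer.Divisibility.Signed as ℤ

  ∣-iterate : ∀ (f : ℕ → ℕ) p a → (∀ {m b} → a ∣ b → b ∣ f m → p * b ∣ f (p * m)) →
    ∀ {m} → a ∣ f m → ∀ i → p ^ i * a ∣ f (p ^ i * m)
  ∣-iterate f p a step {m} a∣fm zero =
    subst₂ (λ x y → x ∣ f y) (sym (+-identityʳ a)) (sym (+-identityʳ m)) a∣fm
  ∣-iterate f p a step {m} a∣fm (suc i) =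
    subst₂ (λ x y → x ∣ f y) (sym (*-assoc p (p ^ i) a)) (sym (*-assoc p (p ^ i) m))
      (step (n∣m*n (p ^ i)) (∣-iterate f p a step a∣fm i))

  p*∣F[p*] : ∀ p m → + p ℤ.∣ W (L m) p → ∀ {b} → b ∣ ∣ F m ∣ → p * b ∣ ∣ F (p * m) ∣
  p*∣F[p*] p m (ℤ.divides r W≡r*p) {b} b∣Fm =
    subst₂ _∣_ (*-comm b p) (sym ∣F[pm]∣≡) (*-pres-∣ b∣Fm (n∣m*n ∣ r ∣))
    where
    open ≡-Reasoning
    ∣F[pm]∣≡ : ∣ F (p * m) ∣ ≡ ∣ F m ∣ * (∣ r ∣ * p)
    ∣F[pm]∣≡ = begin
      ∣ F (p * m) ∣              ≡⟨ cong ∣_∣ (F-* p m) ⟩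
      ∣ F m ℤ.* W (L m) p ∣      ≡⟨ ℤ.abs-* (F m) (W (L m) p) ⟩
      ∣ F m ∣ * ∣ W (L m) p ∣    ≡⟨ cong (λ w → ∣ F m ∣ * ∣ w ∣) W≡r*p ⟩
      ∣ F m ∣ * ∣ r ℤ.* + p ∣    ≡⟨ cong (∣ F m ∣ *_) (ℤ.abs-* r (+ p)) ⟩
      ∣ F m ∣ * (∣ r ∣ * p)      ∎

  3∣W[L]₃ : ∀ m → + 3 ℤ.∣ W (L m) 3
  3∣W[L]₃ m = ℤ.divides (+ 7 ℤ.* s ℤ.+ + 1) (trans (W-3-pell (L m) s (L-sq m)) (ℤ.*-comm (+ 3) _))
    where
    s : ℤ
    s = F m ℤ.* F m

  7∣W[L]₇ : ∀ m → + 7 ℤ.∣ W (L m) 7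
  7∣W[L]₇ m = ℤ.divides (+ 1323 ℤ.* (s ℤ.* s ℤ.* s) ℤ.+ + 441 ℤ.* (s ℤ.* s) ℤ.+ + 42 ℤ.* s ℤ.+ + 1)
    (trans (W-7-pell (L m) s (L-sq m)) (ℤ.*-comm (+ 7) _))
    where
    s : ℤ
    s = F m ℤ.* F m

  p^i∣n⇒p^i∣F : ∀ p → (∀ m → + p ℤ.∣ W (L m) p) → ∀ i {n} → p ^ i ∣ n → p ^ i ∣ ∣ F n ∣
  p^i∣n⇒p^i∣F p p∣W i (divides q refl) =
    subst₂ (λ x y → x ∣ ∣ F y ∣) (*-identityʳ (p ^ i)) (*-comm (p ^ i) q)
      (∣-iterate (λ m → ∣ F m ∣) p 1 (λ {m} _ → p*∣F[p*] p m (p∣W m)) (1∣ ∣ F q ∣) i)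

  8∣F[t*3] : ∀ t → 8 ∣ ∣ F (t * 3) ∣
  8∣F[t*3] t = subst (8 ∣_) (sym (trans (cong ∣_∣ (F-* t 3)) (ℤ.abs-* (+ 24) (W (L 3) t))))
    (∣m⇒∣m*n ∣ W (L 3) t ∣ (divides 3 refl))

  8*2^j∣F : ∀ j {M} → 3 ∣ M → 2 ^ j ∣ M → 2 ^ j * 8 ∣ ∣ F M ∣
  8*2^j∣F j (divides t₀ refl) 2ʲ∣M with p^i∣m*n⇒p^i∣m {m = t₀} j prime[2] (from-no (2 ∣? 3)) 2ʲ∣M
  ... | divides t refl = subst (λ k → 2 ^ j * 8 ∣ ∣ F k ∣) (reorder (2 ^ j) t)
    (∣-iterate (λ m → ∣ F m ∣) 2 8 (λ {m} → step {m}) (8∣F[t*3] t) j)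
    where
    reorder : ∀ q t → q * (t * 3) ≡ t * q * 3
    reorder = solve-∀
    step : ∀ {m b} → 8 ∣ b → b ∣ ∣ F m ∣ → 2 * b ∣ ∣ F (2 * m) ∣
    step {m} 8∣b b∣Fm = p*∣F[p*] 2 m (subst (+ 2 ℤ.∣_) (sym (W-2 (L m))) (2∣F⇒2∣L m (ℤ.∣ᵤ⇒∣ 2∣Fm))) b∣Fm
      where
      2∣Fm : 2 ∣ ∣ F m ∣
      2∣Fm = ∣-trans (divides 4 refl) (∣-trans 8∣b b∣Fm)

  2∣F⇒2^[i+1]∣F : ∀ M → 2 ∣ ∣ F M ∣ → ∀ i → 2 ^ i ∣ M + M → 2 ^ suc i ∣ ∣ F M ∣
  2∣F⇒2^[i+1]∣F M 2∣F zero _ = subst (_∣ ∣ F M ∣) (sym (*-identityʳ 2)) 2∣F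
  2∣F⇒2^[i+1]∣F M 2∣F (suc j) 2ʲ⁺¹∣M+M =
    ∣-trans 2ʲ⁺²∣8*2ʲ (8*2^j∣F j (2∣F⇒3∣ M (ℤ.∣ᵤ⇒∣ 2∣F)) 2ʲ∣M)
    where
    2ʲ∣M : 2 ^ j ∣ M
    2ʲ∣M = *-cancelˡ-∣ 2 (subst (2 ^ suc j ∣_) (cong (λ k → M + k) (sym (+-identityʳ M))) 2ʲ⁺¹∣M+M)
    2ʲ⁺²∣8*2ʲ : 2 ^ suc (suc j) ∣ 2 ^ j * 8
    2ʲ⁺²∣8*2ʲ = divides 2 (regroup (2 ^ j))
      where
      regroup : ∀ q → q * 8 ≡ 2 * (2 * (2 * q))
      regroup = solve-∀

-- The two parities of n
module _ where
  open import Data.Nat using (_+_; _*_; _^_)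
  open import Data.Nat.Properties using (+-suc; +-identityʳ; *-comm; even≢odd)
  open import Data.Nat.Divisibility using (_∣_; divides)
  import Data.Integer as ℤ
  import Data.Integer.Properties as ℤ
  import Data.Integer.Divisibility.Signed as ℤ

  z*z≡+∣z∣² : ∀ z → z ℤ.* z ≡ + (∣ z ∣ * ∣ z ∣)
  z*z≡+∣z∣² (+ n) = ℤ.+◃n≡+n (n * n)
  z*z≡+∣z∣² ℤ.-[1+ n ] = ℤ.+◃n≡+n (suc n * suc n)

  +c*z²≡+ : ∀ c z → + c ℤ.* (z ℤ.* z) ≡ + (c * (∣ z ∣ * ∣ z ∣))
  +c*z²≡+ c z = trans (cong (+ c ℤ.*_) (z*z≡+∣z∣² z)) (sym (ℤ.pos-* c (∣ z ∣ * ∣ z ∣)))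

  gcd-identity-odd-index : ∀ k → GcdIdentity (suc (k + k)) ∣ - + 2 ℤ.+ L (suc (k + k)) ∣ ∣ F (suc (k + k)) ∣
  gcd-identity-odd-index k = subst₂ (GcdIdentity (suc (k + k))) (sym ∣u∣≡3a²) (sym ∣v∣≡ab)
    (gcd-identity-odd a b n-odd pell 3-part)
    where
    A B : ℤ
    A = F k ℤ.+ F (suc k)
    B = F (suc k) ℤ.- F k
    a b : ℕ
    a = ∣ A ∣
    b = ∣ B ∣
    ∣u∣≡3a² : ∣ - + 2 ℤ.+ L (suc (k + k)) ∣ ≡ 3 * (a * a)
    ∣u∣≡3a² = cong ∣_∣ (trans (L-double-suc k) (+c*z²≡+ 3 A))
    ∣v∣≡ab : ∣ F (suc (k + k)) ∣ ≡ a * b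
    ∣v∣≡ab = trans (cong ∣_∣ (F-double-suc k)) (ℤ.abs-* A B)
    pell : 7 * (b * b) ≡ 3 * (a * a) + 4
    pell = ℤ.+-injective (trans (sym (+c*z²≡+ 7 B)) (trans (odd-pell k) (cong (ℤ._+ + 4) (+c*z²≡+ 3 A))))
    n-odd : ¬ 2 ∣ suc (k + k)
    n-odd (divides q eq) =
      even≢odd q k (trans (*-comm 2 q) (trans (sym eq) (cong (λ j → suc (k + j)) (sym (+-identityʳ k)))))
    3-part : ∀ i → 3 ^ i ∣ suc (k + k) → 3 ^ i ∣ a * b
    3-part i 3ⁱ∣n = subst (3 ^ i ∣_) ∣v∣≡ab (p^i∣n⇒p^i∣F 3 3∣W[L]₃ i 3ⁱ∣n)

  gcd-identity-even-index : ∀ k → GcdIdentity (suc k + suc k) ∣ - + 2 ℤ.+ L (suc k + suc k) ∣ ∣ F (suc k + suc k) ∣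
  gcd-identity-even-index k = subst₂ (GcdIdentity (M + M)) (sym ∣u∣≡21c²) (sym ∣v∣≡cd)
    (gcd-identity-even c d 2∣n pell (p-part 3 3∣W[L]₃) (p-part 7 7∣W[L]₇) (2∣F⇒2^[i+1]∣F M))
    where
    M c d : ℕ
    M = suc k
    c = ∣ F M ∣
    d = ∣ L M ∣
    ∣u∣≡21c² : ∣ - + 2 ℤ.+ L (M + M) ∣ ≡ 21 * (c * c)
    ∣u∣≡21c² = cong ∣_∣ (trans (L-double M) (+c*z²≡+ 21 (F M)))
    ∣v∣≡cd : ∣ F (M + M) ∣ ≡ c * d
    ∣v∣≡cd = trans (cong ∣_∣ (F-double M)) (ℤ.abs-* (F M) (L M))
    pell : d * d ≡ 21 * (c * c) + 4
    pell = ℤ.+-injective (trans (sym (z*z≡+∣z∣² (L M))) (trans (L-sq M) (cong (ℤ._+ + 4) (+c*z²≡+ 21 (F M)))))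
    2∣n : 2 ∣ M + M
    2∣n = divides M (trans (cong (λ j → M + j) (sym (+-identityʳ M))) (*-comm 2 M))
    p-part : ∀ p → (∀ m → + p ℤ.∣ W (L m) p) → ∀ i → p ^ i ∣ M + M → p ^ i ∣ c * d
    p-part p p∣W i pⁱ∣n = subst (p ^ i ∣_) ∣v∣≡cd (p^i∣n⇒p^i∣F p p∣W i pⁱ∣n)

  parity : ∀ m → ∃ (λ k → m ≡ k + k) ⊎ ∃ (λ k → m ≡ suc (k + k))
  parity zero = inj₁ (0 , refl)
  parity (suc m) with parity m
  ... | inj₁ (k , refl) = inj₂ (k , refl)
  ... | inj₂ (k , refl) = inj₁ (suc k , cong suc (sym (+-suc k k)))

  gcd-identity-F-L : ∀ m → GcdIdentity (suc m) ∣ - + 2 ℤ.+ L (suc m) ∣ ∣ F (suc m) ∣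
  gcd-identity-F-L m with parity m
  ... | inj₁ (k , refl) = gcd-identity-odd-index k
  ... | inj₂ (k , refl) = subst (λ n → GcdIdentity n ∣ - + 2 ℤ.+ L n ∣ ∣ F n ∣) (cong suc (+-suc k k))
    (gcd-identity-even-index k)

-- Evaluation at 5/2
module _ where
  open import Data.Integer.GCD using (gcd-zeroʳ)
  import Data.Integer as ℤ
  import Data.Integer.Properties as ℤ
  open import Data.Nat.Coprimality using (1-coprimeTo)
  import Data.Nat.Coprimality as Coprime
  open import Data.Rational using (ℚ; mkℚ; ↥_; ↧_; _+_; _*_; _-_; *≡*)
  import Data.Rational as ℚ
  open import Data.Rational.Properties using (↥-/; ↧-/; ≃⇒≡)
  open import Data.Rational.Solver using (module +-*-Solver)
  open +-*-Solver using (solve; _:*_; _:-_; _:=_)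

  -- Unlike ι z = z / 1, which normalises through gcd, this computes on open terms.
  fromℤ : ℤ → ℚ
  fromℤ z = mkℚ z 0 (Coprime.sym (1-coprimeTo ∣ z ∣))

  ↥ι : ∀ z → ↥ ι z ≡ z
  ↥ι z = trans (sym (ℤ.*-identityʳ (↥ ι z))) (trans (cong (↥ ι z ℤ.*_) (sym (gcd-zeroʳ z))) (↥-/ z 1))

  ↧ι : ∀ z → ↧ ι z ≡ + 1
  ↧ι z = trans (sym (ℤ.*-identityʳ (↧ ι z))) (trans (cong (↧ ι z ℤ.*_) (sym (gcd-zeroʳ z))) (↧-/ z 1))

  ι≡fromℤ : ∀ z → ι z ≡ fromℤ z
  ι≡fromℤ z = ≃⇒≡ (*≡* (cong₂ ℤ._*_ (↥ι z) (sym (↧ι z))))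

  ι-injective : ∀ a b → ι a ≡ ι b → a ≡ b
  ι-injective a b eq = trans (sym (↥ι a)) (trans (cong ↥_ eq) (↥ι b))

  ι-+ : ∀ a b → ι (a ℤ.+ b) ≡ ι a + ι b
  ι-+ a b rewrite ι≡fromℤ a | ι≡fromℤ b =
    cong₂ (λ x y → ι (x ℤ.+ y)) (sym (ℤ.*-identityʳ a)) (sym (ℤ.*-identityʳ b))

  ι-* : ∀ a b → ι (a ℤ.* b) ≡ ι a * ι b
  ι-* a b rewrite ι≡fromℤ a | ι≡fromℤ b = refl

  fromℤ-neg : ∀ b → fromℤ (- b) ≡ ℚ.- fromℤ b
  fromℤ-neg (+ zero) = refl
  fromℤ-neg (+ suc n) = refl
  fromℤ-neg ℤ.-[1+ n ] = refl

  ι-neg : ∀ b → ι (- b) ≡ ℚ.- ι b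
  ι-neg b = trans (ι≡fromℤ (- b)) (trans (fromℤ-neg b) (cong ℚ.-_ (sym (ι≡fromℤ b))))

  ι-5*-- : ∀ a b → ι (+ 5 ℤ.* a ℤ.- b) ≡ ι (+ 5) * ι a - ι b
  ι-5*-- a b = trans (ι-+ (+ 5 ℤ.* a) (- b)) (cong₂ _+_ (ι-* (+ 5) a) (ι-neg b))

  U≡ιF : ∀ k → U k five/2 ≡ ι (F (suc k))
  U≡ιF zero = refl
  U≡ιF (suc zero) = refl
  U≡ιF (suc (suc k)) =
    trans (cong₂ (λ x y → ι (+ 5) * x - y) (U≡ιF (suc k)) (U≡ιF k)) (sym (ι-5*-- (F (suc (suc k))) (F (suc k))))

  2T≡ιL : ∀ k → (+ 2 / 1) * T k five/2 ≡ ι (L k)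
  2T≡ιL zero = refl
  2T≡ιL (suc zero) = refl
  2T≡ιL (suc (suc k)) = begin
    two * (five * T (suc k) five/2 - T k five/2)       ≡⟨ distribute two five (T (suc k) five/2) (T k five/2) ⟩
    five * (two * T (suc k) five/2) - two * T k five/2 ≡⟨ cong₂ (λ x y → ι (+ 5) * x - y) (2T≡ιL (suc k)) (2T≡ιL k) ⟩
    ι (+ 5) * ι (L (suc k)) - ι (L k)                  ≡⟨ ι-5*-- (L (suc k)) (L k) ⟨
    ι (L (suc (suc k)))                                ∎
    where
    open ≡-Reasoning
    two five : ℚ
    two = + 2 / 1
    five = two * five/2
    distribute : ∀ c a t₁ t₀ → c * (a * t₁ - t₀) ≡ a * (c * t₁) - c * t₀
    distribute = solve 4 (λ c a t₁ t₀ → c :* (a :* t₁ :- t₀) := a :* (c :* t₁) :- c :* t₀) refl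

  u≡-2+L : ∀ k u → ι u ≡ ι (- + 2) + (+ 2 / 1) * T k five/2 → u ≡ - + 2 ℤ.+ L k
  u≡-2+L k u ιu = ι-injective u (- + 2 ℤ.+ L k)
    (trans ιu (trans (cong (λ x → ι (- + 2) + x) (2T≡ιL k)) (sym (ι-+ (- + 2) (L k)))))

  v≡F : ∀ k v → ι v ≡ U k five/2 → v ≡ F (suc k)
  v≡F k v ιv = ι-injective v (F (suc k)) (trans ιv (U≡ιF k))

open import Data.Integer.GCD using (gcd)
open import Data.Integer.Properties using (abs-*; pos-*)

gcd-identity-ℤ : ∀ n u v → GcdIdentity n ∣ u ∣ ∣ v ∣ →
  gcd u (+ n Data.Integer.* v) ≡ gcd (gcd (+ n) u) v Data.Integer.* gcd u v
gcd-identity-ℤ n u v eq =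
  trans (cong (λ z → gcd u (+ z)) (abs-* (+ n) v)) (trans (cong +_ eq) (pos-* ∣ gcd (gcd (+ n) u) v ∣ ∣ gcd u v ∣))

lemma2 : (m : ℕ) (u v : ℤ) →
    ι u ≡ ι (- (+ 2)) Data.Rational.+ ((+ 2 / 1) Data.Rational.* T (suc m) five/2) →
    ι v ≡ U m five/2 →
    gcd u (+ suc m Data.Integer.* v) ≡ gcd (gcd (+ suc m) u) v Data.Integer.* gcd u v
lemma2 m u v ιu ιv with u≡-2+L (suc m) u ιu | v≡F m v ιv
... | refl | refl = gcd-identity-ℤ (suc m) (- + 2 Data.Integer.+ L (suc m)) (F (suc m)) (gcd-identity-F-L m)
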